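{- $\ell_{\mathbb{Z}[X]}=4$, and \[\mathrm{Irr}(\mathbb{Z}[X])=\{(1,1,1),\ (-1,-1,-1),\ (0,P(X),0,-P(X)),\ (P(X),0,-P(X),0)\ ;\ P\in\mathbb{Z}[X]\setminus\{\pm1\}\}.\]
   Context: All rings are commutative, unitary and nonzero. For a ring $B$ and $a_1,\dots,a_n\in B$, set $M_n(a_1,\dots,a_n)=\begin{pmatrix}a_n&-1\\1&0\end{pmatrix}\cdots\begin{pmatrix}a_1&-1\\1&0\end{pmatrix}$. An $n$-tuple $(a_1,\dots,a_n)\in B^n$ is a $\lambda$-quiddity over $B$ if $M_n(a_1,\dots,a_n)=\epsilon\,\mathrm{Id}$ for some $\epsilon\in\{\pm1_B\}$. For $(a_1,\dots,a_n)\in B^n$, $(b_1,\dots,b_m)\in B^m$ define $(a_1,\dots,a_n)\oplus(b_1,\dots,b_m)=(a_1+b_m,a_2,\dots,a_{n-1},a_n+b_1,b_2,\dots,b_{m-1})$. Two $n$-tuples are equivalent ($\sim$) if one is obtained from the other or from its reversal by a cyclic rotation. A $\lambda$-quiddity $(c_1,\dots,c_n)$ with $n\ge3$ is reducible if there exist a $\lambda$-quiddity $(b_1,\dots,b_l)$ and $(a_1,\dots,a_m)\in B^m$ with $m,l\ge3$ and $(c_1,\dots,c_n)\sim(a_1,\dots,a_m)\oplus(b_1,\dots,b_l)$; otherwise it is irreducible ($(0,0)$ is never irreducible). $\mathrm{Irr}(B)$ is the set of irreducible $\lambda$-quiddities over $B$; $\ell_B$ is the maximal size of its elements if bounded, and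 $+\infty$ otherwise. -}

module Defs where

open import Level using (Level; _⊔_)
open import Algebra.Bundles.Raw using (RawRing)
open import Data.Nat using (ℕ; zero; suc; _≤_)
open import Data.Integer as ℤ using (ℤ)
open import Data.List using (List; []; _∷_; _++_; [_]; length; reverse; map)
open import Data.List.Relation.Binary.Pointwise using (Pointwise)
open import Data.Product using (_×_; _,_; Σ; ∃; ∃-syntax)
open import Data.Sum using (_⊎_)
open import Relation.Nullary using (¬_)
open import Relation.Binary.PropositionalEquality using (_≡_)

-- The polynomial ring ℤ[X]: coefficient lists (constant term first),
-- with equality = equality of all coefficients (so trailing zeros are
-- irrelevant).

Poly : Set
Poly = List ℤ

coeff : Poly → ℕ → ℤ
coeff []       _       = ℤ.0ℤ
coeff (a ∷ p)  zero    = a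
coeff (a ∷ p)  (suc i) = coeff p i

_≈ₚ_ : Poly → Poly → Set
p ≈ₚ q = ∀ i → coeff p i ≡ coeff q i

_+ₚ_ : Poly → Poly → Poly
[]      +ₚ q       = q
(a ∷ p) +ₚ []      = a ∷ p
(a ∷ p) +ₚ (b ∷ q) = (a ℤ.+ b) ∷ (p +ₚ q)

-ₚ_ : Poly → Poly
-ₚ p = map ℤ.-_ p

_·ₚ_ : ℤ → Poly → Poly
a ·ₚ q = map (a ℤ.*_) q

_*ₚ_ : Poly → Poly → Poly
[]      *ₚ q = []
(a ∷ p) *ₚ q = (a ·ₚ q) +ₚ (ℤ.0ℤ ∷ (p *ₚ q))

ℤ[X] : RawRing _ _
ℤ[X] = record
  { Carrier = Poly
  ; _≈_     = _≈ₚ_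
  ; _+_     = _+ₚ_
  ; _*_     = _*ₚ_
  ; -_      = -ₚ_
  ; 0#      = []
  ; 1#      = ℤ.1ℤ ∷ []
  }

module Quiddity {c ℓ : Level} (B : RawRing c ℓ) where
  open RawRing B

  record Mat : Set c where
    constructor mat
    field m11 m12 m21 m22 : Carrier

  _⊗_ : Mat → Mat → Mat
  mat a b c' d ⊗ mat e f g h =
    mat (a * e + b * g) (a * f + b * h) (c' * e + d * g) (c' * f + d * h)

  Id : Mat
  Id = mat 1# 0# 0# 1#

  Elem : Carrier → Mat
  Elem a = mat a (- 1#) 1# 0#

  -- M (a₁ ∷ … ∷ aₙ) = Elem aₙ ⊗ … ⊗ Elem a₁
  M : List Carrier → Mat
  M []       = Id
  M (a ∷ as) = M as ⊗ Elem a

  _≈ₘ_ : Mat → Mat → Set ℓ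
  mat a b c' d ≈ₘ mat e f g h = (a ≈ e) × (b ≈ f) × (c' ≈ g) × (d ≈ h)

  scalarId : Carrier → Mat
  scalarId ε = mat ε 0# 0# ε

  IsLambdaQuiddity : List Carrier → Set ℓ
  IsLambdaQuiddity a = (M a ≈ₘ scalarId 1#) ⊎ (M a ≈ₘ scalarId (- 1#))

  _≋_ : List Carrier → List Carrier → Set (c ⊔ ℓ)
  _≋_ = Pointwise _≈_

  splitLast : Carrier → List Carrier → List Carrier × Carrier
  splitLast x []       = [] , x
  splitLast x (y ∷ ys) with splitLast y ys
  ... | i , l = (x ∷ i) , l

  -- (a₁,…,aₙ) ⊕ (b₁,…,bₘ) = (a₁+bₘ, a₂,…,aₙ₋₁, aₙ+b₁, b₂,…,bₘ₋₁).
  -- Only meaningful for n, m ≥ 2 (it is only used for n, m ≥ 3);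
  -- the remaining cases are filled arbitrarily.
  _⊕_ : List Carrier → List Carrier → List Carrier
  (a₁ ∷ x ∷ xs) ⊕ (b₁ ∷ y ∷ ys) with splitLast x xs | splitLast y ys
  ... | amid , aₙ | bmid , bₘ = (a₁ + bₘ) ∷ amid ++ ((aₙ + b₁) ∷ bmid)
  a ⊕ b = a ++ b

  rot : List Carrier → List Carrier
  rot []       = []
  rot (x ∷ xs) = xs ++ [ x ]

  rotate : ℕ → List Carrier → List Carrier
  rotate zero    a = a
  rotate (suc k) a = rotate k (rot a)

  _∼_ : List Carrier → List Carrier → Set (c ⊔ ℓ)
  c' ∼ d = ∃[ k ] ((c' ≋ rotate k d) ⊎ (c' ≋ rotate k (reverse d)))

  Reducible : List Carrier → Set (c ⊔ ℓ)
  Reducible c' =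
    ∃[ a ] ∃[ b ] (3 ≤ length a × 3 ≤ length b × IsLambdaQuiddity b × c' ∼ (a ⊕ b))

  Irreducible : List Carrier → Set (c ⊔ ℓ)
  Irreducible c' = 3 ≤ length c' × IsLambdaQuiddity c' × ¬ Reducible c'

  MaxIrrSize : ℕ → Set (c ⊔ ℓ)
  MaxIrrSize n =
    (∀ c' → Irreducible c' → length c' ≤ n) × (∃[ c' ] (Irreducible c' × length c' ≡ n))

-- A λ-quiddity of size 3 over a commutative ring is (1,1,1) or (-1,-1,-1), and one of size 4,
-- (a,b,c,d), has 1 - cb = ±1, with a = 0 and d = -b when c = 0, and d = 0 and c = -a when b = 0.
-- Gluing on (ε,ε,ε) or (0,y,0,-y) shows that a tuple of size at least 4 with an entry ±1, or of
-- size at least 5 with an entry 0, is reducible; and a reducible tuple of size 4 is a gluing of two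
-- triples, hence has an entry ±1. So an irreducible tuple of size at least 5 over ℤ[X] has all its
-- entries outside {0, 1, -1}. Evaluated at a large integer these entries have absolute value at
-- least 2, and over ℤ such a tuple is never a λ-quiddity, since the first entry of its matrix grows
-- strictly along the product. The same evaluation forces b = 0 or c = 0 in an irreducible 4-tuple.
-- Evaluation at all natural numbers is injective on ℤ[X], which is also how ℤ[X] is shown to be a
-- commutative ring.

module Submission where

open import Defs
open import Data.List using (List; []; _∷_)
open import Data.Product using (_×_; ∃-syntax)
open import Data.Sum using (_⊎_)
open import Function.Bundles using (_⇔_)
open import Relation.Nullary using (¬_)
open import Algebra.Bundles using (RawRing)

open import Level using (Level; 0ℓ)
open import Algebra.Bundles using (CommutativeRing)
import Algebra.Construct.Pointwise as PointwiseRing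
open import Algebra.Morphism.Structures using (module RingMorphisms)
import Algebra.Morphism.RingMonomorphism as RingMonomorphism
open import Algebra.Solver.Ring.AlmostCommutativeRing using (fromCommutativeRing; _-Raw-AlmostCommutative⟶_)
import Algebra.Solver.Ring
open import Data.Empty using (⊥-elim)
open import Data.Integer as ℤ using (ℤ; 0ℤ; 1ℤ; +_; ∣_∣)
import Data.Integer.Properties as ℤ
open import Data.Integer.Tactic.RingSolver using (solve-∀)
open import Data.List using (_++_; [_]; _∷ʳ_; length; reverse; map; initLast; _∷ʳ′_)
import Data.List.Properties as List
open import Data.List.Membership.Propositional using (find)
open import Data.List.Membership.Propositional.Properties using (∈-∃++)
open import Data.List.Relation.Binary.Pointwise as Pointwise using ([]; _∷_)
open import Data.List.Relation.Binary.Permutation.Propositional using (_↭_; ↭-sym; ↭-trans; ↭-refl)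
open import Data.List.Relation.Binary.Permutation.Propositional.Properties using (∷↭∷ʳ; ↭-reverse; ↭-length; Any-resp-↭)
open import Data.List.Relation.Unary.All as All using (All; []; _∷_)
import Data.List.Relation.Unary.All.Properties as AllProperties
open import Data.List.Relation.Unary.All.Properties.Core using (¬Any⇒All¬; All¬⇒¬Any)
open import Data.List.Relation.Unary.Any using (Any; here; there)
import Data.Maybe as Maybe
open import Data.Nat as ℕ using (ℕ; zero; suc; _≤_; _<_; z≤n; s≤s)
import Data.Nat.Properties as ℕ
open import Data.Product using (_,_; proj₁; proj₂)
open import Data.Sum as Sum using (inj₁; inj₂)
open import Function using (_∘_)
open import Function.Bundles using (mk⇔)
open import Relation.Binary using (Decidable; _Respects_)
open import Relation.Binary.PropositionalEquality as ≡ using (_≡_)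
open import Relation.Nullary using (Dec; yes; no; contradiction)
import Relation.Nullary.Decidable as Dec
open import Relation.Nullary.Decidable using (_×-dec_; _⊎-dec_; from-yes; from-no; dec⇒maybe)

open RingMorphisms using (IsRingHomomorphism; IsRingMonomorphism)

-- Evaluation of polynomials

eval : Poly → ℤ → ℤ
eval []      t = 0ℤ
eval (a ∷ p) t = a ℤ.+ t ℤ.* eval p t

‖_‖ : Poly → ℕ
‖ [] ‖    = 0
‖ a ∷ p ‖ = ∣ a ∣ ℕ.+ ‖ p ‖

head×tail⇔≈ₚ : ∀ p q → (coeff p 0 ≡ coeff q 0 × (∀ i → coeff p (suc i) ≡ coeff q (suc i))) ⇔ p ≈ₚ q
head×tail⇔≈ₚ p q = mk⇔ (λ (e₀ , e) → λ { zero → e₀ ; (suc i) → e i }) (λ e → e 0 , e ∘ suc)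

infix 4 _≟ₚ_ _≈ᵒ_ _≟ᵒ_

_≟ₚ_ : Decidable _≈ₚ_
[]      ≟ₚ []      = yes λ _ → ≡.refl
[]      ≟ₚ (b ∷ q) = Dec.map (head×tail⇔≈ₚ [] (b ∷ q)) (0ℤ ℤ.≟ b ×-dec [] ≟ₚ q)
(a ∷ p) ≟ₚ []      = Dec.map (head×tail⇔≈ₚ (a ∷ p) []) (a ℤ.≟ 0ℤ ×-dec p ≟ₚ [])
(a ∷ p) ≟ₚ (b ∷ q) = Dec.map (head×tail⇔≈ₚ (a ∷ p) (b ∷ q)) (a ℤ.≟ b ×-dec p ≟ₚ q)

0+t*0≡0 : ∀ t → 0ℤ ℤ.+ t ℤ.* 0ℤ ≡ 0ℤ
0+t*0≡0 t = ≡.cong (λ v → 0ℤ ℤ.+ v) (ℤ.*-zeroʳ t)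

eval-cong : ∀ p q → p ≈ₚ q → ∀ t → eval p t ≡ eval q t
eval-cong []      []      _ t = ≡.refl
eval-cong []      (b ∷ q) e t =
  ≡.trans (≡.sym (0+t*0≡0 t)) (≡.cong₂ (λ a v → a ℤ.+ t ℤ.* v) (e 0) (eval-cong [] q (e ∘ suc) t))
eval-cong (a ∷ p) []      e t =
  ≡.trans (≡.cong₂ (λ a v → a ℤ.+ t ℤ.* v) (e 0) (eval-cong p [] (e ∘ suc) t)) (0+t*0≡0 t)
eval-cong (a ∷ p) (b ∷ q) e t = ≡.cong₂ (λ a v → a ℤ.+ t ℤ.* v) (e 0) (eval-cong p q (e ∘ suc) t)

eval-+ : ∀ p q t → eval (p +ₚ q) t ≡ eval p t ℤ.+ eval q t
eval-+ []      q       t = ≡.sym (ℤ.+-identityˡ _)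
eval-+ (a ∷ p) []      t = ≡.sym (ℤ.+-identityʳ _)
eval-+ (a ∷ p) (b ∷ q) t = ≡.trans (≡.cong (λ v → a ℤ.+ b ℤ.+ t ℤ.* v) (eval-+ p q t)) (shuffle a b t (eval p t) (eval q t))
  where
  shuffle : ∀ a b t x y → a ℤ.+ b ℤ.+ t ℤ.* (x ℤ.+ y) ≡ a ℤ.+ t ℤ.* x ℤ.+ (b ℤ.+ t ℤ.* y)
  shuffle = solve-∀

eval-neg : ∀ p t → eval (-ₚ p) t ≡ ℤ.- eval p t
eval-neg []      t = ≡.refl
eval-neg (a ∷ p) t = ≡.trans (≡.cong (λ v → ℤ.- a ℤ.+ t ℤ.* v) (eval-neg p t)) (negate a t (eval p t))
  where
  negate : ∀ a t x → ℤ.- a ℤ.+ t ℤ.* ℤ.- x ≡ ℤ.- (a ℤ.+ t ℤ.* x)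
  negate = solve-∀

eval-· : ∀ c p t → eval (c ·ₚ p) t ≡ c ℤ.* eval p t
eval-· c []      t = ≡.sym (ℤ.*-zeroʳ c)
eval-· c (a ∷ p) t = ≡.trans (≡.cong (λ v → c ℤ.* a ℤ.+ t ℤ.* v) (eval-· c p t)) (factor c a t (eval p t))
  where
  factor : ∀ c a t x → c ℤ.* a ℤ.+ t ℤ.* (c ℤ.* x) ≡ c ℤ.* (a ℤ.+ t ℤ.* x)
  factor = solve-∀

eval-* : ∀ p q t → eval (p *ₚ q) t ≡ eval p t ℤ.* eval q t
eval-* []      q t = ≡.refl
eval-* (a ∷ p) q t = begin
  eval ((a ·ₚ q) +ₚ (0ℤ ∷ (p *ₚ q))) t               ≡⟨ eval-+ (a ·ₚ q) (0ℤ ∷ (p *ₚ q)) t ⟩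
  eval (a ·ₚ q) t ℤ.+ (0ℤ ℤ.+ t ℤ.* eval (p *ₚ q) t)
    ≡⟨ ≡.cong₂ (λ u v → u ℤ.+ (0ℤ ℤ.+ t ℤ.* v)) (eval-· a q t) (eval-* p q t) ⟩
  a ℤ.* y ℤ.+ (0ℤ ℤ.+ t ℤ.* (eval p t ℤ.* y))        ≡⟨ factor a t (eval p t) y ⟩
  (a ℤ.+ t ℤ.* eval p t) ℤ.* y                       ∎
  where
  open ≡.≡-Reasoning
  y = eval q t
  factor : ∀ a t x y → a ℤ.* y ℤ.+ (0ℤ ℤ.+ t ℤ.* (x ℤ.* y)) ≡ (a ℤ.+ t ℤ.* x) ℤ.* y
  factor = solve-∀

eval-1 : ∀ t → eval (1ℤ ∷ []) t ≡ 1ℤ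
eval-1 t = ≡.cong (λ v → 1ℤ ℤ.+ v) (ℤ.*-zeroʳ t)

∣j∣≤∣i+j∣+∣i∣ : ∀ i j → ∣ j ∣ ≤ ∣ i ℤ.+ j ∣ ℕ.+ ∣ i ∣
∣j∣≤∣i+j∣+∣i∣ i j =
  ≡.subst (λ k → ∣ k ∣ ≤ ∣ i ℤ.+ j ∣ ℕ.+ ∣ i ∣) (cancel i j) (ℤ.∣i-j∣≤∣i∣+∣j∣ (i ℤ.+ j) i)
  where
  cancel : ∀ i j → i ℤ.+ j ℤ.- i ≡ j
  cancel = solve-∀

nonzero-constant : ∀ p → ¬ p ≈ₚ [] → ∀ b → p ≈ₚ [ b ] → 1 ≤ ∣ b ∣
nonzero-constant p p≉0 (+ zero)   p≈0 = contradiction (λ { zero → p≈0 zero ; (suc i) → p≈0 (suc i) }) p≉0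
nonzero-constant p _   (+ suc _)  _   = s≤s z≤n
nonzero-constant p _   ℤ.-[1+ _ ] _   = s≤s z≤n

eval-large : ∀ k p {t} → (∀ a → p ≈ₚ [ a ] → k ≤ ∣ a ∣) → ‖ p ‖ ℕ.+ k ≤ t → k ≤ ∣ eval p (+ t) ∣
eval-large zero    _       _     _ = z≤n
eval-large (suc k) []      const _ = const 0ℤ λ { zero → ≡.refl ; (suc i) → ≡.refl }
eval-large (suc k) (a ∷ p) {t} const bound with p ≟ₚ []
... | yes p≈0 = ≡.subst (λ v → suc k ≤ ∣ v ∣) (≡.sym eval≡a) (const a λ { zero → ≡.refl ; (suc i) → p≈0 i })
  where
  eval≡a : eval (a ∷ p) (+ t) ≡ a
  eval≡a = ≡.trans (≡.cong (λ v → a ℤ.+ + t ℤ.* v) (eval-cong p [] p≈0 (+ t)))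
                   (≡.trans (≡.cong (λ v → a ℤ.+ v) (ℤ.*-zeroʳ (+ t))) (ℤ.+-identityʳ a))
... | no p≉0 = ℕ.+-cancelʳ-≤ ∣ a ∣ (suc k) _ (begin
    suc k ℕ.+ ∣ a ∣                  ≡⟨ ℕ.+-comm (suc k) ∣ a ∣ ⟩
    ∣ a ∣ ℕ.+ suc k                  ≤⟨ ℕ.+-monoˡ-≤ (suc k) (ℕ.m≤m+n ∣ a ∣ ‖ p ‖) ⟩
    ‖ a ∷ p ‖ ℕ.+ suc k              ≤⟨ bound ⟩
    t                                ≡⟨ ℕ.*-identityʳ t ⟨
    t ℕ.* 1                          ≤⟨ ℕ.*-monoʳ-≤ t (eval-large 1 p (nonzero-constant p p≉0) tail-bound) ⟩
    t ℕ.* ∣ eval p (+ t) ∣           ≡⟨ ℤ.∣i*j∣≡∣i∣*∣j∣ (+ t) (eval p (+ t)) ⟨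
    ∣ + t ℤ.* eval p (+ t) ∣         ≤⟨ ∣j∣≤∣i+j∣+∣i∣ a (+ t ℤ.* eval p (+ t)) ⟩
    ∣ eval (a ∷ p) (+ t) ∣ ℕ.+ ∣ a ∣ ∎)
  where
  open ℕ.≤-Reasoning
  tail-bound : ‖ p ‖ ℕ.+ 1 ≤ t
  tail-bound = ℕ.≤-trans (ℕ.+-monoʳ-≤ ‖ p ‖ (s≤s z≤n))
    (ℕ.≤-trans (ℕ.m≤n+m _ ∣ a ∣) (ℕ.≤-trans (ℕ.≤-reflexive (≡.sym (ℕ.+-assoc ∣ a ∣ ‖ p ‖ (suc k)))) bound))

coeff-+ : ∀ p q i → coeff (p +ₚ q) i ≡ coeff p i ℤ.+ coeff q i
coeff-+ []      q       i       = ≡.sym (ℤ.+-identityˡ _)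
coeff-+ (a ∷ p) []      i       = ≡.sym (ℤ.+-identityʳ _)
coeff-+ (a ∷ p) (b ∷ q) zero    = ≡.refl
coeff-+ (a ∷ p) (b ∷ q) (suc i) = coeff-+ p q i

coeff-neg : ∀ p i → coeff (-ₚ p) i ≡ ℤ.- coeff p i
coeff-neg []      i       = ≡.refl
coeff-neg (a ∷ p) zero    = ≡.refl
coeff-neg (a ∷ p) (suc i) = coeff-neg p i

eval-injective : ∀ {p q} → (∀ n → eval p (+ n) ≡ eval q (+ n)) → p ≈ₚ q
eval-injective {p} {q} p≡q i = ℤ.i-j≡0⇒i≡j _ _ (begin
  coeff p i ℤ.- coeff q i       ≡⟨ ≡.cong (λ v → coeff p i ℤ.+ v) (coeff-neg q i) ⟨
  coeff p i ℤ.+ coeff (-ₚ q) i  ≡⟨ coeff-+ p (-ₚ q) i ⟨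
  coeff d i                     ≡⟨ d≈0 i ⟩
  0ℤ                            ∎)
  where
  open ≡.≡-Reasoning
  d = p +ₚ (-ₚ q)
  vanishes : ∀ n → eval d (+ n) ≡ 0ℤ
  vanishes n = ≡.trans (eval-+ p (-ₚ q) (+ n))
    (≡.trans (≡.cong (λ v → eval p (+ n) ℤ.+ v) (eval-neg q (+ n))) (ℤ.i≡j⇒i-j≡0 (p≡q n)))
  d≈0 : d ≈ₚ []
  d≈0 with d ≟ₚ []
  ... | yes d≈0 = d≈0
  ... | no  d≉0 =
    contradiction (≡.subst (λ v → 1 ≤ ∣ v ∣) (vanishes _) (eval-large 1 d (nonzero-constant d d≉0) ℕ.≤-refl)) λ ()

-- ℤ[X] as a commutative ring

-- Agda cannot infer the implicit arguments of equational lemmas stated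
-- with _≈ₚ_, which unfolds to a Π-type over coefficients; with the copy it can, and unfolding it
-- makes ℤ[X]ᵒ definitionally equal to ℤ[X].
opaque
  _≈ᵒ_ : Poly → Poly → Set
  p ≈ᵒ q = p ≈ₚ q

opaque
  unfolding _≈ᵒ_

  ≈ₚ⇒≈ᵒ : ∀ {p q} → p ≈ₚ q → p ≈ᵒ q
  ≈ₚ⇒≈ᵒ p≈q = p≈q

  ≈ᵒ⇒≈ₚ : ∀ {p q} → p ≈ᵒ q → p ≈ₚ q
  ≈ᵒ⇒≈ₚ p≈q = p≈q

_≟ᵒ_ : Decidable _≈ᵒ_
p ≟ᵒ q = Dec.map′ ≈ₚ⇒≈ᵒ ≈ᵒ⇒≈ₚ (p ≟ₚ q)

ℤ[X]ᵒ : RawRing 0ℓ 0ℓ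
ℤ[X]ᵒ = record { Carrier = Poly ; _≈_ = _≈ᵒ_ ; _+_ = _+ₚ_ ; _*_ = _*ₚ_ ; -_ = -ₚ_ ; 0# = [] ; 1# = 1ℤ ∷ [] }

ℤ^ℕ : CommutativeRing 0ℓ 0ℓ
ℤ^ℕ = PointwiseRing.commutativeRing ℕ ℤ.+-*-commutativeRing

evalAt-isRingHomomorphism : ∀ t → IsRingHomomorphism ℤ[X]ᵒ ℤ.+-*-rawRing (λ p → eval p t)
evalAt-isRingHomomorphism t = record
  { isSemiringHomomorphism = record
    { isNearSemiringHomomorphism = record
      { +-isMonoidHomomorphism = record
        { isMagmaHomomorphism = record
          { isRelHomomorphism = record { cong = λ {p} {q} p≈q → eval-cong p q (≈ᵒ⇒≈ₚ p≈q) t }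
          ; homo = λ p q → eval-+ p q t
          }
        ; ε-homo = ≡.refl
        }
      ; *-homo = λ p q → eval-* p q t
      }
    ; 1#-homo = eval-1 t
    }
  ; -‿homo = λ p → eval-neg p t
  }

eval-isRingMonomorphism : IsRingMonomorphism ℤ[X]ᵒ (CommutativeRing.rawRing ℤ^ℕ) (λ p n → eval p (+ n))
eval-isRingMonomorphism = record
  { isRingHomomorphism = record
    { isSemiringHomomorphism = record
      { isNearSemiringHomomorphism = record
        { +-isMonoidHomomorphism = record
          { isMagmaHomomorphism = record
            { isRelHomomorphism = record { cong = λ {p} {q} p≈q n → eval-cong p q (≈ᵒ⇒≈ₚ p≈q) (+ n) }
            ; homo = λ p q n → eval-+ p q (+ n)
            }
          ; ε-homo = λ n → ≡.refl
          }
        ; *-homo = λ p q n → eval-* p q (+ n)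
        }
      ; 1#-homo = λ n → eval-1 (+ n)
      }
    ; -‿homo = λ p n → eval-neg p (+ n)
    }
  ; injective = λ {p} {q} → ≈ₚ⇒≈ᵒ ∘ eval-injective {p} {q}
  }

ℤ[X]-commutativeRing : CommutativeRing 0ℓ 0ℓ
ℤ[X]-commutativeRing = record
  { isCommutativeRing = RingMonomorphism.isCommutativeRing eval-isRingMonomorphism (CommutativeRing.isCommutativeRing ℤ^ℕ) }

-- λ-quiddities over a commutative ring

module QuiddityProperties {c ℓ : Level} (R : CommutativeRing c ℓ) where

  open CommutativeRing R
  open import Algebra.Properties.Ring ring using (-‿involutive; -‿injective; -0#≈0#; -1*x≈-x)
  import Relation.Binary.Reasoning.Setoid setoid as ≈-Reasoning
  open Quiddity rawRing
  open Mat

  IsSign : Carrier → Set ℓ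
  IsSign x = x ≈ 1# ⊎ x ≈ - 1#

  IsSign-resp : IsSign Respects _≈_
  IsSign-resp x≈y (inj₁ x≈1)  = inj₁ (trans (sym x≈y) x≈1)
  IsSign-resp x≈y (inj₂ x≈-1) = inj₂ (trans (sym x≈y) x≈-1)

  sign⁻ : ∀ {x} → IsSign (- x) → IsSign x
  sign⁻ {x} (inj₁ -x≈1)  = inj₂ (trans (sym (-‿involutive x)) (-‿cong -x≈1))
  sign⁻ {x} (inj₂ -x≈-1) = inj₁ (-‿injective -x≈-1)

  sign-square : ∀ {s} → IsSign s → s * s ≈ 1#
  sign-square (inj₁ s≈1)  = trans (*-cong s≈1 s≈1) (*-identityˡ 1#)
  sign-square {s} (inj₂ s≈-1) = begin
    s * s        ≈⟨ *-cong s≈-1 s≈-1 ⟩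
    - 1# * - 1#  ≈⟨ -1*x≈-x (- 1#) ⟩
    - - 1#       ≈⟨ -‿involutive 1# ⟩
    1#           ∎
    where open ≈-Reasoning

  sign-inverse : ∀ {s x} → IsSign s → s * x ≈ 1# → x ≈ s
  sign-inverse {s} {x} s± sx≈1 = begin
    x            ≈⟨ *-identityˡ x ⟨
    1# * x       ≈⟨ *-congʳ (sign-square s±) ⟨
    s * s * x    ≈⟨ *-assoc s s x ⟩
    s * (s * x)  ≈⟨ *-congˡ sx≈1 ⟩
    s * 1#       ≈⟨ *-identityʳ s ⟩
    s            ∎
    where open ≈-Reasoning

  -x≈0⇒x≈0 : ∀ {x} → - x ≈ 0# → x ≈ 0#
  -x≈0⇒x≈0 {x} -x≈0 = begin
    x      ≈⟨ -‿involutive x ⟨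
    - - x  ≈⟨ -‿cong -x≈0 ⟩
    - 0#   ≈⟨ -0#≈0# ⟩
    0#     ∎
    where open ≈-Reasoning

  ≋-refl : ∀ {xs} → xs ≋ xs
  ≋-refl = Pointwise.refl refl

  ≋-sym : ∀ {xs ys} → xs ≋ ys → ys ≋ xs
  ≋-sym = Pointwise.symmetric sym

  sign-triple : ∀ {x y z} → IsSign y → y * x ≈ 1# → y * z ≈ 1# →
                (x ∷ y ∷ z ∷ []) ≋ (1# ∷ 1# ∷ 1# ∷ []) ⊎ (x ∷ y ∷ z ∷ []) ≋ (- 1# ∷ - 1# ∷ - 1# ∷ [])
  sign-triple y± yx≈1 yz≈1 with x≈y ← sign-inverse y± yx≈1 | z≈y ← sign-inverse y± yz≈1 with y±
  ... | inj₁ y≈1  = inj₁ (trans x≈y y≈1 ∷ y≈1 ∷ trans z≈y y≈1 ∷ [])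
  ... | inj₂ y≈-1 = inj₂ (trans x≈y y≈-1 ∷ y≈-1 ∷ trans z≈y y≈-1 ∷ [])

  ≈ₘ-trans : ∀ {m n p} → m ≈ₘ n → n ≈ₘ p → m ≈ₘ p
  ≈ₘ-trans (e₁ , e₂ , e₃ , e₄) (f₁ , f₂ , f₃ , f₄) = trans e₁ f₁ , trans e₂ f₂ , trans e₃ f₃ , trans e₄ f₄

  ≈ₘ-sym : ∀ {m n} → m ≈ₘ n → n ≈ₘ m
  ≈ₘ-sym (e₁ , e₂ , e₃ , e₄) = sym e₁ , sym e₂ , sym e₃ , sym e₄

  ⊗-cong : ∀ {m m′ n n′} → m ≈ₘ m′ → n ≈ₘ n′ → (m ⊗ n) ≈ₘ (m′ ⊗ n′)
  ⊗-cong (a , b , c , d) (e , f , g , h) =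
    +-cong (*-cong a e) (*-cong b g) , +-cong (*-cong a f) (*-cong b h) ,
    +-cong (*-cong c e) (*-cong d g) , +-cong (*-cong c f) (*-cong d h)

  M-cong : ∀ {xs ys} → xs ≋ ys → M xs ≈ₘ M ys
  M-cong []            = refl , refl , refl , refl
  M-cong (x≈y ∷ xs≋ys) = ⊗-cong (M-cong xs≋ys) (x≈y , refl , refl , refl)

  λ-quiddity-resp : IsLambdaQuiddity Respects _≋_
  λ-quiddity-resp xs≋ys (inj₁ M≈1)  = inj₁ (≈ₘ-trans (M-cong (≋-sym xs≋ys)) M≈1)
  λ-quiddity-resp xs≋ys (inj₂ M≈-1) = inj₂ (≈ₘ-trans (M-cong (≋-sym xs≋ys)) M≈-1)

  λ-quiddity? : Decidable _≈_ → ∀ xs → Dec (IsLambdaQuiddity xs)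
  λ-quiddity? _≟_ xs = equals 1# ⊎-dec equals (- 1#)
    where
    equals : ∀ ε → Dec (M xs ≈ₘ scalarId ε)
    equals ε = (m11 (M xs) ≟ ε) ×-dec (m12 (M xs) ≟ 0#) ×-dec (m21 (M xs) ≟ 0#) ×-dec (m22 (M xs) ≟ ε)

  λ-quiddity⇒m11-sign : ∀ {xs} → IsLambdaQuiddity xs → IsSign (m11 (M xs))
  λ-quiddity⇒m11-sign (inj₁ (e , _)) = inj₁ e
  λ-quiddity⇒m11-sign (inj₂ (e , _)) = inj₂ e

  λ-quiddity⇒m12≈0 : ∀ {xs} → IsLambdaQuiddity xs → m12 (M xs) ≈ 0#
  λ-quiddity⇒m12≈0 (inj₁ (_ , e , _)) = e
  λ-quiddity⇒m12≈0 (inj₂ (_ , e , _)) = e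

  λ-quiddity⇒m21≈0 : ∀ {xs} → IsLambdaQuiddity xs → m21 (M xs) ≈ 0#
  λ-quiddity⇒m21≈0 (inj₁ (_ , _ , e , _)) = e
  λ-quiddity⇒m21≈0 (inj₂ (_ , _ , e , _)) = e

  λ-quiddity⇒m22-sign : ∀ {xs} → IsLambdaQuiddity xs → IsSign (m22 (M xs))
  λ-quiddity⇒m22-sign (inj₁ (_ , _ , _ , e)) = inj₁ e
  λ-quiddity⇒m22-sign (inj₂ (_ , _ , _ , e)) = inj₂ e

  rot-≋ : ∀ {xs ys} → xs ≋ ys → rot xs ≋ rot ys
  rot-≋ []            = []
  rot-≋ (x≈y ∷ xs≋ys) = Pointwise.++⁺ xs≋ys (x≈y ∷ [])

  rotate-≋ : ∀ k {xs ys} → xs ≋ ys → rotate k xs ≋ rotate k ys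
  rotate-≋ zero    xs≋ys = xs≋ys
  rotate-≋ (suc k) xs≋ys = rotate-≋ k (rot-≋ xs≋ys)

  rot-↭ : ∀ xs → rot xs ↭ xs
  rot-↭ []       = ↭-refl
  rot-↭ (x ∷ xs) = ↭-sym (∷↭∷ʳ x xs)

  rotate-↭ : ∀ k xs → rotate k xs ↭ xs
  rotate-↭ zero    xs = ↭-refl
  rotate-↭ (suc k) xs = ↭-trans (rotate-↭ k (rot xs)) (rot-↭ xs)

  rotate-++ : ∀ xs ys → rotate (length xs) (xs ++ ys) ≡ ys ++ xs
  rotate-++ []       ys = ≡.sym (List.++-identityʳ ys)
  rotate-++ (x ∷ xs) ys = begin
    rotate (length xs) ((xs ++ ys) ++ [ x ]) ≡⟨ ≡.cong (rotate (length xs)) (List.++-assoc xs ys [ x ]) ⟩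
    rotate (length xs) (xs ++ ys ∷ʳ x)       ≡⟨ rotate-++ xs (ys ∷ʳ x) ⟩
    (ys ∷ʳ x) ++ xs                          ≡⟨ List.++-assoc ys [ x ] xs ⟩
    ys ++ x ∷ xs                             ∎
    where open ≡.≡-Reasoning

  ∼⇒≋↭ : ∀ {xs ys} → xs ∼ ys → ∃[ zs ] (xs ≋ zs × zs ↭ ys)
  ∼⇒≋↭ {ys = ys} (k , inj₁ xs≋) = rotate k ys , xs≋ , rotate-↭ k ys
  ∼⇒≋↭ {ys = ys} (k , inj₂ xs≋) = rotate k (reverse ys) , xs≋ , ↭-trans (rotate-↭ k (reverse ys)) (↭-reverse ys)

  ∼-length : ∀ {xs ys} → xs ∼ ys → length xs ≡ length ys
  ∼-length xs∼ys with zs , xs≋zs , zs↭ys ← ∼⇒≋↭ xs∼ys = ≡.trans (Pointwise.Pointwise-length xs≋zs) (↭-length zs↭ys)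

  ∼-Any : ∀ {p} {P : Carrier → Set p} → P Respects _≈_ → ∀ {xs ys} → xs ∼ ys → Any P ys → Any P xs
  ∼-Any resp xs∼ys any with zs , xs≋zs , zs↭ys ← ∼⇒≋↭ xs∼ys =
    Pointwise.Any-resp-Pointwise resp (≋-sym xs≋zs) (Any-resp-↭ (↭-sym zs↭ys) any)

  Any⇒rotation : ∀ {p} {P : Carrier → Set p} {xs} → Any P xs →
                 ∃[ k ] ∃[ w ] ∃[ e ] (xs ≡ rotate k (w ∷ʳ e) × P e × length xs ≡ suc (length w))
  Any⇒rotation any with e , e∈xs , Pe ← find any with p , s , ≡.refl ← ∈-∃++ e∈xs =
    length s , s ++ p , e , ≡.sym rotation , Pe , ≡.trans (List.length-++-sucʳ p e s) (≡.cong suc (List.length-++-comm p s))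
    where
    open ≡.≡-Reasoning
    rotation : rotate (length s) ((s ++ p) ∷ʳ e) ≡ p ++ e ∷ s
    rotation = begin
      rotate (length s) ((s ++ p) ∷ʳ e) ≡⟨ ≡.cong (rotate (length s)) (List.++-assoc s p [ e ]) ⟩
      rotate (length s) (s ++ p ∷ʳ e)   ≡⟨ rotate-++ s (p ∷ʳ e) ⟩
      (p ∷ʳ e) ++ s                     ≡⟨ List.++-assoc p [ e ] s ⟩
      p ++ e ∷ s                        ∎

  splitLast-∷ʳ : ∀ x xs z → splitLast x (xs ∷ʳ z) ≡ (x ∷ xs , z)
  splitLast-∷ʳ x []       z = ≡.refl
  splitLast-∷ʳ x (y ∷ ys) z rewrite splitLast-∷ʳ y ys z = ≡.refl

  length-splitLast : ∀ x xs → length (proj₁ (splitLast x xs)) ≡ length xs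
  length-splitLast x []       = ≡.refl
  length-splitLast x (y ∷ ys) = ≡.cong suc (length-splitLast y ys)

  ⊕-∷ʳ : ∀ a₁ v aₙ b₁ u bₘ → (a₁ ∷ v ∷ʳ aₙ) ⊕ (b₁ ∷ u ∷ʳ bₘ) ≡ (a₁ + bₘ) ∷ v ++ (aₙ + b₁) ∷ u
  ⊕-∷ʳ a₁ []       aₙ b₁ []       bₘ = ≡.refl
  ⊕-∷ʳ a₁ []       aₙ b₁ (u₁ ∷ u) bₘ rewrite splitLast-∷ʳ u₁ u bₘ = ≡.refl
  ⊕-∷ʳ a₁ (v₁ ∷ v) aₙ b₁ []       bₘ rewrite splitLast-∷ʳ v₁ v aₙ = ≡.refl
  ⊕-∷ʳ a₁ (v₁ ∷ v) aₙ b₁ (u₁ ∷ u) bₘ rewrite splitLast-∷ʳ v₁ v aₙ | splitLast-∷ʳ u₁ u bₘ = ≡.refl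

  length-⊕ : ∀ a₁ x xs b₁ y ys → length ((a₁ ∷ x ∷ xs) ⊕ (b₁ ∷ y ∷ ys)) ≡ 2 ℕ.+ (length xs ℕ.+ length ys)
  length-⊕ a₁ x xs b₁ y ys with splitLast x xs | length-splitLast x xs | splitLast y ys | length-splitLast y ys
  ... | amid , _ | ∣amid∣ | bmid , _ | ∣bmid∣ = ≡.cong suc (begin
    length (amid ++ _ ∷ bmid)         ≡⟨ List.length-++ amid ⟩
    length amid ℕ.+ suc (length bmid) ≡⟨ ℕ.+-suc (length amid) (length bmid) ⟩
    suc (length amid ℕ.+ length bmid) ≡⟨ ≡.cong₂ (λ m n → suc (m ℕ.+ n)) ∣amid∣ ∣bmid∣ ⟩
    suc (length xs ℕ.+ length ys)     ∎)
    where open ≡.≡-Reasoning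

  3≤length⇒∷∷∷ : ∀ (xs : List Carrier) → 3 ≤ length xs → ∃[ x ] ∃[ y ] ∃[ z ] ∃[ zs ] (xs ≡ x ∷ y ∷ z ∷ zs)
  3≤length⇒∷∷∷ (x ∷ y ∷ z ∷ zs) _              = x , y , z , zs , ≡.refl
  3≤length⇒∷∷∷ (_ ∷ _ ∷ [])     (s≤s (s≤s ()))
  3≤length⇒∷∷∷ (_ ∷ [])         (s≤s ())

  3≤length⇒∷∷ʳ : ∀ (w : List Carrier) → 3 ≤ length w → ∃[ x ] ∃[ v ] ∃[ z ] (w ≡ x ∷ v ∷ʳ z × 1 ≤ length v)
  3≤length⇒∷∷ʳ (x ∷ w) (s≤s 2≤∣w∣) with initLast w
  ... | []      = contradiction 2≤∣w∣ λ ()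
  ... | v ∷ʳ′ z = x , v , z , ≡.refl , ℕ.+-cancelʳ-≤ 1 1 (length v) (≡.subst (2 ≤_) (List.length-++ v {[ z ]}) 2≤∣w∣)

  3≤length-∷∷ʳ : ∀ (x : Carrier) v z → 1 ≤ length v → 3 ≤ length (x ∷ v ∷ʳ z)
  3≤length-∷∷ʳ x v z 1≤∣v∣ = s≤s (≡.subst (2 ≤_) (≡.sym (List.length-++ v {[ z ]})) (ℕ.+-monoˡ-≤ 1 1≤∣v∣))

  reducible⇒4≤length : ∀ {xs} → Reducible xs → 4 ≤ length xs
  reducible⇒4≤length (a , b , 3≤a , 3≤b , _ , xs∼a⊕b)
    with a₁ , x , x′ , as , ≡.refl ← 3≤length⇒∷∷∷ a 3≤a
    with b₁ , y , y′ , bs , ≡.refl ← 3≤length⇒∷∷∷ b 3≤b =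
    ≡.subst (4 ≤_) (≡.sym (≡.trans (∼-length xs∼a⊕b) (length-⊕ a₁ x (x′ ∷ as) b₁ y (y′ ∷ bs))))
      (s≤s (s≤s (s≤s (ℕ.≤-trans (s≤s z≤n) (ℕ.m≤n+m _ (length as))))))

  reducible₄⇒gluing₃ : ∀ {xs} → Reducible xs → length xs ≡ 4 →
    ∃[ a₁ ] ∃[ a₂ ] ∃[ a₃ ] ∃[ b₁ ] ∃[ b₂ ] ∃[ b₃ ]
      (IsLambdaQuiddity (b₁ ∷ b₂ ∷ b₃ ∷ []) × xs ∼ ((a₁ + b₃) ∷ a₂ ∷ (a₃ + b₁) ∷ b₂ ∷ []))
  reducible₄⇒gluing₃ {xs} (a , b , 3≤a , 3≤b , b-quiddity , xs∼a⊕b) ∣xs∣≡4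
    with a₁ , a₂ , a₃ , as , ≡.refl ← 3≤length⇒∷∷∷ a 3≤a
    with b₁ , b₂ , b₃ , bs , ≡.refl ← 3≤length⇒∷∷∷ b 3≤b = shorten as bs b-quiddity xs∼a⊕b
    where
    shorten : ∀ as bs → IsLambdaQuiddity (b₁ ∷ b₂ ∷ b₃ ∷ bs) →
              xs ∼ ((a₁ ∷ a₂ ∷ a₃ ∷ as) ⊕ (b₁ ∷ b₂ ∷ b₃ ∷ bs)) →
      ∃[ a₁ ] ∃[ a₂ ] ∃[ a₃ ] ∃[ b₁ ] ∃[ b₂ ] ∃[ b₃ ]
        (IsLambdaQuiddity (b₁ ∷ b₂ ∷ b₃ ∷ []) × xs ∼ ((a₁ + b₃) ∷ a₂ ∷ (a₃ + b₁) ∷ b₂ ∷ []))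
    shorten []       []       q xs∼ = a₁ , a₂ , a₃ , b₁ , b₂ , b₃ , q , xs∼
    shorten []       (_ ∷ bs) q xs∼
      with () ← ≡.trans (≡.sym ∣xs∣≡4) (≡.trans (∼-length xs∼) (length-⊕ a₁ a₂ (a₃ ∷ []) b₁ b₂ (b₃ ∷ _ ∷ bs)))
    shorten (_ ∷ as) bs       q xs∼ =
      ⊥-elim (ℕ.1+n≢0 (≡.sym (≡.trans (ℕ.+-cancelˡ-≡ 4 0 _ ∣xs∣≡4+k) (ℕ.+-suc (length as) (length bs)))))
      where
      ∣xs∣≡4+k = ≡.trans (≡.sym ∣xs∣≡4) (≡.trans (∼-length xs∼) (length-⊕ a₁ a₂ (a₃ ∷ _ ∷ as) b₁ b₂ (b₃ ∷ bs)))

  gluing⇒reducible : ∀ k {a₁ v aₙ b₁ u bₘ xs} → 1 ≤ length v → 1 ≤ length u →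
                     IsLambdaQuiddity (b₁ ∷ u ∷ʳ bₘ) → xs ≋ ((a₁ + bₘ) ∷ v ++ (aₙ + b₁) ∷ u) → Reducible (rotate k xs)
  gluing⇒reducible k {a₁} {v} {aₙ} {b₁} {u} {bₘ} {xs} 1≤∣v∣ 1≤∣u∣ b-quiddity xs≋a⊕b =
    (a₁ ∷ v ∷ʳ aₙ) , (b₁ ∷ u ∷ʳ bₘ) ,
    3≤length-∷∷ʳ a₁ v aₙ 1≤∣v∣ , 3≤length-∷∷ʳ b₁ u bₘ 1≤∣u∣ , b-quiddity ,
    k , inj₁ (rotate-≋ k (≡.subst (xs ≋_) (≡.sym (⊕-∷ʳ a₁ v aₙ b₁ u bₘ)) xs≋a⊕b))

module HomomorphicImage {a ℓa b ℓb : Level} (A : CommutativeRing a ℓa) (B : CommutativeRing b ℓb)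
  {h : CommutativeRing.Carrier A → CommutativeRing.Carrier B}
  (hom : IsRingHomomorphism (CommutativeRing.rawRing A) (CommutativeRing.rawRing B) h) where

  open CommutativeRing B
  open IsRingHomomorphism hom
  open QuiddityProperties B using (IsSign; ≈ₘ-trans; ≈ₘ-sym; ⊗-cong)
  private
    module A where
      open CommutativeRing A public
      open Quiddity (CommutativeRing.rawRing A) public
      open QuiddityProperties A public using (IsSign)
    module B = Quiddity rawRing

  mapₘ : A.Mat → B.Mat
  mapₘ (A.mat x y z w) = B.mat (h x) (h y) (h z) (h w)

  ⊗-homo : ∀ m n → mapₘ (m A.⊗ n) B.≈ₘ (mapₘ m B.⊗ mapₘ n)
  ⊗-homo (A.mat x y z w) (A.mat x′ y′ z′ w′) = entry x x′ y z′ , entry x y′ y w′ , entry z x′ w z′ , entry z y′ w w′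
    where
    entry : ∀ p q r s → h (p A.* q A.+ r A.* s) ≈ h p * h q + h r * h s
    entry p q r s = trans (+-homo _ _) (+-cong (*-homo p q) (*-homo r s))

  h-1≈-1 : h (A.- A.1#) ≈ - 1#
  h-1≈-1 = trans (-‿homo A.1#) (-‿cong 1#-homo)

  M-homo : ∀ xs → mapₘ (A.M xs) B.≈ₘ B.M (map h xs)
  M-homo []       = 1#-homo , 0#-homo , 0#-homo , 1#-homo
  M-homo (x ∷ xs) = ≈ₘ-trans (⊗-homo (A.M xs) (A.Elem x)) (⊗-cong (M-homo xs) (refl , h-1≈-1 , 1#-homo , 0#-homo))

  λ-quiddity-map : ∀ {xs} → A.IsLambdaQuiddity xs → B.IsLambdaQuiddity (map h xs)
  λ-quiddity-map {xs} (inj₁ (e₁ , e₂ , e₃ , e₄)) = inj₁ (≈ₘ-trans (≈ₘ-sym (M-homo xs))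
    (trans (⟦⟧-cong e₁) 1#-homo , trans (⟦⟧-cong e₂) 0#-homo , trans (⟦⟧-cong e₃) 0#-homo , trans (⟦⟧-cong e₄) 1#-homo))
  λ-quiddity-map {xs} (inj₂ (e₁ , e₂ , e₃ , e₄)) = inj₂ (≈ₘ-trans (≈ₘ-sym (M-homo xs))
    (trans (⟦⟧-cong e₁) h-1≈-1 , trans (⟦⟧-cong e₂) 0#-homo , trans (⟦⟧-cong e₃) 0#-homo , trans (⟦⟧-cong e₄) h-1≈-1))

  sign-map : ∀ {x} → A.IsSign x → IsSign (h x)
  sign-map (inj₁ x≈1)  = inj₁ (trans (⟦⟧-cong x≈1) 1#-homo)
  sign-map (inj₂ x≈-1) = inj₂ (trans (⟦⟧-cong x≈-1) h-1≈-1)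

-- λ-quiddities over ℤ

module _ where
  open Quiddity (CommutativeRing.rawRing ℤ.+-*-commutativeRing)
  open Mat
  open QuiddityProperties ℤ.+-*-commutativeRing using (IsSign; λ-quiddity⇒m11-sign)

  ∣u∣<∣v+x*u∣ : ∀ u v x → 2 ≤ ∣ x ∣ → ∣ v ∣ < ∣ u ∣ → ∣ u ∣ < ∣ v ℤ.+ x ℤ.* u ∣
  ∣u∣<∣v+x*u∣ u v x 2≤∣x∣ ∣v∣<∣u∣ = ℕ.+-cancelʳ-< ∣ u ∣ ∣ u ∣ _ (begin-strict
    ∣ u ∣ ℕ.+ ∣ u ∣             ≡⟨ ≡.cong (ℕ._+_ ∣ u ∣) (ℕ.+-identityʳ ∣ u ∣) ⟨
    2 ℕ.* ∣ u ∣                 ≤⟨ ℕ.*-monoˡ-≤ ∣ u ∣ 2≤∣x∣ ⟩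
    ∣ x ∣ ℕ.* ∣ u ∣             ≡⟨ ℤ.∣i*j∣≡∣i∣*∣j∣ x u ⟨
    ∣ x ℤ.* u ∣                 ≤⟨ ∣j∣≤∣i+j∣+∣i∣ v (x ℤ.* u) ⟩
    ∣ v ℤ.+ x ℤ.* u ∣ ℕ.+ ∣ v ∣ <⟨ ℕ.+-monoʳ-< ∣ v ℤ.+ x ℤ.* u ∣ ∣v∣<∣u∣ ⟩
    ∣ v ℤ.+ x ℤ.* u ∣ ℕ.+ ∣ u ∣ ∎)
    where open ℕ.≤-Reasoning

  M-growth : ∀ {xs} → All (λ x → 2 ≤ ∣ x ∣) xs → ∣ m12 (M xs) ∣ < ∣ m11 (M xs) ∣ × length xs < ∣ m11 (M xs) ∣
  M-growth []                       = s≤s z≤n , s≤s z≤n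
  M-growth {x ∷ xs} (2≤∣x∣ ∷ large) with ∣v∣<∣u∣ , ∣xs∣<∣u∣ ← M-growth large =
    ≡.subst (_< ∣ m11 (M (x ∷ xs)) ∣) (≡.sym ∣m12∣≡∣u∣) ∣u∣<∣m11∣ , ℕ.≤-<-trans ∣xs∣<∣u∣ ∣u∣<∣m11∣
    where
    u = m11 (M xs)
    v = m12 (M xs)
    rearrange : ∀ u v x → u ℤ.* x ℤ.+ v ℤ.* 1ℤ ≡ v ℤ.+ x ℤ.* u
    rearrange = solve-∀
    negation : ∀ u v → u ℤ.* ℤ.- 1ℤ ℤ.+ v ℤ.* 0ℤ ≡ ℤ.- u
    negation = solve-∀
    ∣m12∣≡∣u∣ : ∣ m12 (M (x ∷ xs)) ∣ ≡ ∣ u ∣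
    ∣m12∣≡∣u∣ = ≡.trans (≡.cong ∣_∣ (negation u v)) (ℤ.∣-i∣≡∣i∣ u)
    ∣u∣<∣m11∣ : ∣ u ∣ < ∣ m11 (M (x ∷ xs)) ∣
    ∣u∣<∣m11∣ = ≡.subst (λ w → ∣ u ∣ < ∣ w ∣) (≡.sym (rearrange u v x)) (∣u∣<∣v+x*u∣ u v x 2≤∣x∣ ∣v∣<∣u∣)

  no-large-λ-quiddity : ∀ {xs} → 1 ≤ length xs → All (λ x → 2 ≤ ∣ x ∣) xs → ¬ IsLambdaQuiddity xs
  no-large-λ-quiddity {xs} 1≤∣xs∣ large quiddity =
    ℕ.<-irrefl (≡.sym ∣m11∣≡1) (ℕ.≤-<-trans 1≤∣xs∣ (proj₂ (M-growth large)))
    where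
    ∣m11∣≡1 : ∣ m11 (M xs) ∣ ≡ 1
    ∣m11∣≡1 = Sum.[ ≡.cong ∣_∣ , ≡.cong ∣_∣ ] (λ-quiddity⇒m11-sign {xs} quiddity)

  1-xy-not-sign : ∀ x y → 2 ≤ ∣ x ∣ → 2 ≤ ∣ y ∣ → ¬ IsSign (1ℤ ℤ.- x ℤ.* y)
  1-xy-not-sign x y 2≤∣x∣ 2≤∣y∣ sign = ℕ.<⇒≱ (s≤s (s≤s (s≤s z≤n))) (ℕ.≤-trans 4≤∣xy∣ (∣xy∣≤2 sign))
    where
    4≤∣xy∣ : 4 ≤ ∣ x ℤ.* y ∣
    4≤∣xy∣ = ≡.subst (4 ≤_) (≡.sym (ℤ.∣i*j∣≡∣i∣*∣j∣ x y)) (ℕ.*-mono-≤ 2≤∣x∣ 2≤∣y∣)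
    rearrange : ∀ x y → x ℤ.* y ≡ 1ℤ ℤ.- (1ℤ ℤ.- x ℤ.* y)
    rearrange = solve-∀
    xy≡1-s : ∀ {s} → 1ℤ ℤ.- x ℤ.* y ≡ s → x ℤ.* y ≡ 1ℤ ℤ.- s
    xy≡1-s ≡s = ≡.trans (rearrange x y) (≡.cong (λ s → 1ℤ ℤ.- s) ≡s)
    ∣xy∣≤2 : IsSign (1ℤ ℤ.- x ℤ.* y) → ∣ x ℤ.* y ∣ ≤ 2
    ∣xy∣≤2 (inj₁ s≡1)  = ≡.subst (λ w → ∣ w ∣ ≤ 2) (≡.sym (xy≡1-s s≡1)) z≤n
    ∣xy∣≤2 (inj₂ s≡-1) = ≡.subst (λ w → ∣ w ∣ ≤ 2) (≡.sym (xy≡1-s s≡-1)) ℕ.≤-refl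

-- λ-quiddities over ℤ[X]

module _ where
  open CommutativeRing ℤ[X]-commutativeRing
  open import Algebra.Properties.Ring ring using (x∙y⁻¹≈ε⇒x≈y; +-inverseˡ-unique)
  open Quiddity ℤ[X]ᵒ
  open Mat
  open QuiddityProperties ℤ[X]-commutativeRing
  module Eval t = HomomorphicImage ℤ[X]-commutativeRing ℤ.+-*-commutativeRing (evalAt-isRingHomomorphism t)

  -- The zero constant is [] itself, so that the solver's con 0ℤ and con 1ℤ denote 0# and 1#
  -- definitionally; Syntax below relies on this.
  constant : ℤ → Poly
  constant (+ zero) = []
  constant c        = [ c ]

  constant≈[_] : ∀ c → constant c ≈ [ c ]
  constant≈[ + zero ]     = from-yes ([] ≟ᵒ [ 0ℤ ])
  constant≈[ + suc _ ]    = refl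
  constant≈[ ℤ.-[1+ _ ] ] = refl

  constant-morphism : ℤ.+-*-rawRing -Raw-AlmostCommutative⟶ fromCommutativeRing ℤ[X]-commutativeRing
  constant-morphism = record
    { ⟦_⟧    = constant
    ; +-homo = λ a b → trans constant≈[ a ℤ.+ b ] (sym (+-cong constant≈[ a ] constant≈[ b ]))
    ; *-homo = λ a b → trans constant≈[ a ℤ.* b ] (trans ([ab]≈[a][b] a b) (sym (*-cong constant≈[ a ] constant≈[ b ])))
    ; -‿homo = λ a → trans constant≈[ ℤ.- a ] (sym (-‿cong constant≈[ a ]))
    ; 0-homo = refl
    ; 1-homo = refl
    }
    where
    [ab]≈[a][b] : ∀ a b → [ a ℤ.* b ] ≈ [ a ] * [ b ]
    [ab]≈[a][b] _ _ = ≈ₚ⇒≈ᵒ λ { zero → ≡.sym (ℤ.+-identityʳ _) ; (suc _) → ≡.refl }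

  constant-≟ : ∀ a b → Maybe.Maybe (constant a ≈ constant b)
  constant-≟ a b = Maybe.map (reflexive ∘ ≡.cong constant) (dec⇒maybe (a ℤ.≟ b))

  open Algebra.Solver.Ring ℤ.+-*-rawRing (fromCommutativeRing ℤ[X]-commutativeRing) constant-morphism constant-≟

  -- Solver expressions form a raw ring; M computed over it gives expressions whose denotations are
  -- definitionally the entries of M, so entry identities can be handed to solve.
  Syntax : ℕ → RawRing 0ℓ 0ℓ
  Syntax n = record
    { Carrier = Polynomial n ; _≈_ = _≡_ ; _+_ = _:+_ ; _*_ = _:*_ ; -_ = :-_ ; 0# = con 0ℤ ; 1# = con 1ℤ }

  module Sym {n} = Quiddity (Syntax n)

  M₃-m12 : ∀ x y z → m12 (M (x ∷ y ∷ z ∷ [])) ≈ 1# - z * y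
  M₃-m12 = solve 3 (λ x y z → Sym.Mat.m12 (Sym.M (x ∷ y ∷ z ∷ [])) := con 1ℤ :- z :* y) refl

  M₃-m21 : ∀ x y z → m21 (M (x ∷ y ∷ z ∷ [])) ≈ y * x - 1#
  M₃-m21 = solve 3 (λ x y z → Sym.Mat.m21 (Sym.M (x ∷ y ∷ z ∷ [])) := y :* x :- con 1ℤ) refl

  M₃-m22 : ∀ x y z → m22 (M (x ∷ y ∷ z ∷ [])) ≈ - y
  M₃-m22 = solve 3 (λ x y z → Sym.Mat.m22 (Sym.M (x ∷ y ∷ z ∷ [])) := :- y) refl

  M₄-m22 : ∀ a b c d → m22 (M (a ∷ b ∷ c ∷ d ∷ [])) ≈ 1# - c * b
  M₄-m22 = solve 4 (λ a b c d → Sym.Mat.m22 (Sym.M (a ∷ b ∷ c ∷ d ∷ [])) := con 1ℤ :- c :* b) refl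

  M₄-m12[c=0] : ∀ a b d → m12 (M (a ∷ b ∷ 0# ∷ d ∷ [])) ≈ d + b
  M₄-m12[c=0] = solve 3 (λ a b d → Sym.Mat.m12 (Sym.M (a ∷ b ∷ con 0ℤ ∷ d ∷ [])) := d :+ b) refl

  M₄-m21[c=0] : ∀ a b d → m21 (M (a ∷ b ∷ 0# ∷ d ∷ [])) ≈ - a
  M₄-m21[c=0] = solve 3 (λ a b d → Sym.Mat.m21 (Sym.M (a ∷ b ∷ con 0ℤ ∷ d ∷ [])) := :- a) refl

  M₄-m12[b=0] : ∀ a c d → m12 (M (a ∷ 0# ∷ c ∷ d ∷ [])) ≈ d
  M₄-m12[b=0] = solve 3 (λ a c d → Sym.Mat.m12 (Sym.M (a ∷ con 0ℤ ∷ c ∷ d ∷ [])) := d) refl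

  M₄-m21[b=0] : ∀ a c d → m21 (M (a ∷ 0# ∷ c ∷ d ∷ [])) ≈ - (c + a)
  M₄-m21[b=0] = solve 3 (λ a c d → Sym.Mat.m21 (Sym.M (a ∷ con 0ℤ ∷ c ∷ d ∷ [])) := :- (c :+ a)) refl

  0P0-P-quiddity : ∀ p → IsLambdaQuiddity (0# ∷ p ∷ 0# ∷ - p ∷ [])
  0P0-P-quiddity p = inj₁ (m11≈1 p , m12≈0 p , m21≈0 p , m22≈1 p)
    where
    m11≈1 : ∀ p → m11 (M (0# ∷ p ∷ 0# ∷ - p ∷ [])) ≈ 1#
    m11≈1 = solve 1 (λ p → Sym.Mat.m11 (Sym.M (con 0ℤ ∷ p ∷ con 0ℤ ∷ :- p ∷ [])) := con 1ℤ) refl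
    m12≈0 : ∀ p → m12 (M (0# ∷ p ∷ 0# ∷ - p ∷ [])) ≈ 0#
    m12≈0 = solve 1 (λ p → Sym.Mat.m12 (Sym.M (con 0ℤ ∷ p ∷ con 0ℤ ∷ :- p ∷ [])) := con 0ℤ) refl
    m21≈0 : ∀ p → m21 (M (0# ∷ p ∷ 0# ∷ - p ∷ [])) ≈ 0#
    m21≈0 = solve 1 (λ p → Sym.Mat.m21 (Sym.M (con 0ℤ ∷ p ∷ con 0ℤ ∷ :- p ∷ [])) := con 0ℤ) refl
    m22≈1 : ∀ p → m22 (M (0# ∷ p ∷ 0# ∷ - p ∷ [])) ≈ 1#
    m22≈1 = solve 1 (λ p → Sym.Mat.m22 (Sym.M (con 0ℤ ∷ p ∷ con 0ℤ ∷ :- p ∷ [])) := con 1ℤ) refl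

  P0-P0-quiddity : ∀ p → IsLambdaQuiddity (p ∷ 0# ∷ - p ∷ 0# ∷ [])
  P0-P0-quiddity p = inj₁ (m11≈1 p , m12≈0 p , m21≈0 p , m22≈1 p)
    where
    m11≈1 : ∀ p → m11 (M (p ∷ 0# ∷ - p ∷ 0# ∷ [])) ≈ 1#
    m11≈1 = solve 1 (λ p → Sym.Mat.m11 (Sym.M (p ∷ con 0ℤ ∷ :- p ∷ con 0ℤ ∷ [])) := con 1ℤ) refl
    m12≈0 : ∀ p → m12 (M (p ∷ 0# ∷ - p ∷ 0# ∷ [])) ≈ 0#
    m12≈0 = solve 1 (λ p → Sym.Mat.m12 (Sym.M (p ∷ con 0ℤ ∷ :- p ∷ con 0ℤ ∷ [])) := con 0ℤ) refl
    m21≈0 : ∀ p → m21 (M (p ∷ 0# ∷ - p ∷ 0# ∷ [])) ≈ 0#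
    m21≈0 = solve 1 (λ p → Sym.Mat.m21 (Sym.M (p ∷ con 0ℤ ∷ :- p ∷ con 0ℤ ∷ [])) := con 0ℤ) refl
    m22≈1 : ∀ p → m22 (M (p ∷ 0# ∷ - p ∷ 0# ∷ [])) ≈ 1#
    m22≈1 = solve 1 (λ p → Sym.Mat.m22 (Sym.M (p ∷ con 0ℤ ∷ :- p ∷ con 0ℤ ∷ [])) := con 1ℤ) refl

  sign-triple-quiddity : ∀ {s} → IsSign s → IsLambdaQuiddity (s ∷ s ∷ s ∷ [])
  sign-triple-quiddity (inj₁ s≈1)  =
    λ-quiddity-resp (sym s≈1 ∷ sym s≈1 ∷ sym s≈1 ∷ []) (from-yes (λ-quiddity? _≟ᵒ_ (1# ∷ 1# ∷ 1# ∷ [])))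
  sign-triple-quiddity (inj₂ s≈-1) =
    λ-quiddity-resp (sym s≈-1 ∷ sym s≈-1 ∷ sym s≈-1 ∷ []) (from-yes (λ-quiddity? _≟ᵒ_ (- 1# ∷ - 1# ∷ - 1# ∷ [])))

  quiddity₃ : ∀ {x y z} → IsLambdaQuiddity (x ∷ y ∷ z ∷ []) →
              (x ∷ y ∷ z ∷ []) ≋ (1# ∷ 1# ∷ 1# ∷ []) ⊎ (x ∷ y ∷ z ∷ []) ≋ (- 1# ∷ - 1# ∷ - 1# ∷ [])
  quiddity₃ {x} {y} {z} q =
    sign-triple (sign⁻ (IsSign-resp (M₃-m22 x y z) (λ-quiddity⇒m22-sign {x ∷ y ∷ z ∷ []} q))) yx≈1 yz≈1
    where
    yx≈1 : y * x ≈ 1#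
    yx≈1 = x∙y⁻¹≈ε⇒x≈y (y * x) 1# (trans (sym (M₃-m21 x y z)) (λ-quiddity⇒m21≈0 {x ∷ y ∷ z ∷ []} q))
    yz≈1 : y * z ≈ 1#
    yz≈1 = trans (*-comm y z)
      (sym (x∙y⁻¹≈ε⇒x≈y 1# (z * y) (trans (sym (M₃-m12 x y z)) (λ-quiddity⇒m12≈0 {x ∷ y ∷ z ∷ []} q))))

  quiddity₄[c≈0] : ∀ {a b c d} → IsLambdaQuiddity (a ∷ b ∷ c ∷ d ∷ []) → c ≈ 0# →
                   (a ∷ b ∷ c ∷ d ∷ []) ≋ (0# ∷ b ∷ 0# ∷ - b ∷ [])
  quiddity₄[c≈0] {a} {b} {c} {d} q c≈0 = a≈0 ∷ refl ∷ c≈0 ∷ d≈-b ∷ []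
    where
    q′ : IsLambdaQuiddity (a ∷ b ∷ 0# ∷ d ∷ [])
    q′ = λ-quiddity-resp {a ∷ b ∷ c ∷ d ∷ []} (refl ∷ refl ∷ c≈0 ∷ refl ∷ []) q
    a≈0 : a ≈ 0#
    a≈0 = -x≈0⇒x≈0 (trans (sym (M₄-m21[c=0] a b d)) (λ-quiddity⇒m21≈0 {a ∷ b ∷ 0# ∷ d ∷ []} q′))
    d≈-b : d ≈ - b
    d≈-b = +-inverseˡ-unique d b (trans (sym (M₄-m12[c=0] a b d)) (λ-quiddity⇒m12≈0 {a ∷ b ∷ 0# ∷ d ∷ []} q′))

  quiddity₄[b≈0] : ∀ {a b c d} → IsLambdaQuiddity (a ∷ b ∷ c ∷ d ∷ []) → b ≈ 0# →
                   (a ∷ b ∷ c ∷ d ∷ []) ≋ (a ∷ 0# ∷ - a ∷ 0# ∷ [])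
  quiddity₄[b≈0] {a} {b} {c} {d} q b≈0 = refl ∷ b≈0 ∷ c≈-a ∷ d≈0 ∷ []
    where
    q′ : IsLambdaQuiddity (a ∷ 0# ∷ c ∷ d ∷ [])
    q′ = λ-quiddity-resp {a ∷ b ∷ c ∷ d ∷ []} (refl ∷ b≈0 ∷ refl ∷ refl ∷ []) q
    d≈0 : d ≈ 0#
    d≈0 = trans (sym (M₄-m12[b=0] a c d)) (λ-quiddity⇒m12≈0 {a ∷ 0# ∷ c ∷ d ∷ []} q′)
    c≈-a : c ≈ - a
    c≈-a = +-inverseˡ-unique c a
      (-x≈0⇒x≈0 (trans (sym (M₄-m21[b=0] a c d)) (λ-quiddity⇒m21≈0 {a ∷ 0# ∷ c ∷ d ∷ []} q′)))

  quiddity₄-sign : ∀ {a b c d} → IsLambdaQuiddity (a ∷ b ∷ c ∷ d ∷ []) → IsSign (1# - c * b)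
  quiddity₄-sign {a} {b} {c} {d} q = IsSign-resp (M₄-m22 a b c d) (λ-quiddity⇒m22-sign {a ∷ b ∷ c ∷ d ∷ []} q)

  sign? : ∀ x → Dec (IsSign x)
  sign? x = (x ≟ᵒ 1#) ⊎-dec (x ≟ᵒ - 1#)

  x≈x-y+y : ∀ x y → x ≈ x - y + y
  x≈x-y+y = solve 2 (λ x y → x := x :- y :+ y) refl

  x≈x+y-y : ∀ x y → x ≈ x + y - y
  x≈x+y-y = solve 2 (λ x y → x := x :+ y :- y) refl

  sign-last⇒reducible : ∀ k w {e} → IsSign e → 3 ≤ length w → Reducible (rotate k (w ∷ʳ e))
  sign-last⇒reducible k w {e} e± 3≤∣w∣ with x , v , z , ≡.refl , 1≤∣v∣ ← 3≤length⇒∷∷ʳ w 3≤∣w∣ =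
    gluing⇒reducible k {x - e} {v} {z - e} {e} {[ e ]} {e} 1≤∣v∣ (s≤s z≤n) (sign-triple-quiddity e±) glued
    where
    glued : ((x ∷ v ∷ʳ z) ∷ʳ e) ≋ ((x - e + e) ∷ v ++ (z - e + e) ∷ [ e ])
    glued = x≈x-y+y x e ∷ ≡.subst (_≋ (v ++ (z - e + e) ∷ [ e ])) (≡.sym (List.++-assoc v [ z ] [ e ]))
                                   (Pointwise.++⁺ ≋-refl (x≈x-y+y z e ∷ refl ∷ []))

  zero-last⇒reducible : ∀ k w {y e} → e ≈ 0# → 3 ≤ length w → Reducible (rotate k ((w ∷ʳ y) ∷ʳ e))
  zero-last⇒reducible k w {y} {e} e≈0 3≤∣w∣ with x , v , z , ≡.refl , 1≤∣v∣ ← 3≤length⇒∷∷ʳ w 3≤∣w∣ =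
    gluing⇒reducible k {x + y} {v} {z} {0#} {y ∷ 0# ∷ []} { - y} 1≤∣v∣ (s≤s z≤n) (0P0-P-quiddity y) glued
    where
    glued : (((x ∷ v ∷ʳ z) ∷ʳ y) ∷ʳ e) ≋ ((x + y - y) ∷ v ++ (z + 0#) ∷ y ∷ 0# ∷ [])
    glued = x≈x+y-y x y ∷ ≡.subst (_≋ (v ++ (z + 0#) ∷ y ∷ 0# ∷ []))
                                   (≡.sym (≡.trans (List.++-assoc (v ∷ʳ z) [ y ] [ e ]) (List.++-assoc v [ z ] (y ∷ e ∷ []))))
                                   (Pointwise.++⁺ ≋-refl (sym (+-identityʳ z) ∷ refl ∷ e≈0 ∷ []))

  sign-entry⇒reducible : ∀ {xs} → Any IsSign xs → 4 ≤ length xs → Reducible xs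
  sign-entry⇒reducible any 4≤∣xs∣ with k , w , e , ≡.refl , e± , ∣xs∣≡1+∣w∣ ← Any⇒rotation any =
    sign-last⇒reducible k w e± (ℕ.s≤s⁻¹ (≡.subst (4 ≤_) ∣xs∣≡1+∣w∣ 4≤∣xs∣))

  zero-entry⇒reducible : ∀ {xs} → Any (_≈ 0#) xs → 5 ≤ length xs → Reducible xs
  zero-entry⇒reducible any 5≤∣xs∣
    with k , w′ , e , ≡.refl , e≈0 , ∣xs∣≡1+∣w′∣ ← Any⇒rotation any
    with initLast w′
  ... | []      = contradiction (≡.subst (5 ≤_) ∣xs∣≡1+∣w′∣ 5≤∣xs∣) λ { (s≤s ()) }
  ... | w ∷ʳ′ y = zero-last⇒reducible k w e≈0 (ℕ.+-cancelʳ-≤ 1 3 (length w) 4≤∣w∣+1)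
    where
    4≤∣w∣+1 : 4 ≤ length w ℕ.+ 1
    4≤∣w∣+1 = ≡.subst (4 ≤_) (List.length-++ w {[ y ]}) (ℕ.s≤s⁻¹ (≡.subst (5 ≤_) ∣xs∣≡1+∣w′∣ 5≤∣xs∣))

  middle-sign : ∀ {x y z} → IsLambdaQuiddity (x ∷ y ∷ z ∷ []) → IsSign y
  middle-sign {x} {y} {z} q = Sum.map second second (quiddity₃ {x} {y} {z} q)
    where
    second : ∀ {s} → (x ∷ y ∷ z ∷ []) ≋ (s ∷ s ∷ s ∷ []) → y ≈ s
    second = Pointwise.head ∘ Pointwise.tail

  reducible₄⇒sign-entry : ∀ {xs} → Reducible xs → length xs ≡ 4 → Any IsSign xs
  reducible₄⇒sign-entry r ∣xs∣≡4 with _ , _ , _ , b₁ , b₂ , b₃ , q , xs∼glued ← reducible₄⇒gluing₃ r ∣xs∣≡4 =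
    ∼-Any IsSign-resp xs∼glued (there (there (there (here (middle-sign {b₁} {b₂} {b₃} q)))))

  Nondegenerate : Poly → Set
  Nondegenerate p = ¬ p ≈ 0# × ¬ IsSign p

  nondegenerate-large : ∀ {p t} → Nondegenerate p → ‖ p ‖ ℕ.+ 2 ≤ t → 2 ≤ ∣ eval p (+ t) ∣
  nondegenerate-large {p} (p≉0 , p≉±1) = eval-large 2 p large-constant
    where
    large-constant : ∀ a → p ≈ₚ [ a ] → 2 ≤ ∣ a ∣
    large-constant (+ 0)             p≈0  = contradiction (trans (≈ₚ⇒≈ᵒ p≈0) (from-yes ([ 0ℤ ] ≟ᵒ []))) p≉0
    large-constant (+ 1)             p≈1  = contradiction (inj₁ (≈ₚ⇒≈ᵒ p≈1)) p≉±1
    large-constant (+ suc (suc _))   _    = s≤s (s≤s z≤n)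
    large-constant ℤ.-[1+ 0 ]        p≈-1 = contradiction (inj₂ (≈ₚ⇒≈ᵒ p≈-1)) p≉±1
    large-constant ℤ.-[1+ suc _ ]    _    = s≤s (s≤s z≤n)

  eventually-large : ∀ {ps} → All Nondegenerate ps → ∃[ t₀ ] ∀ {t} → t₀ ≤ t → All (λ p → 2 ≤ ∣ eval p (+ t) ∣) ps
  eventually-large []                           = 0 , λ _ → []
  eventually-large {p ∷ _} (p-nondeg ∷ nondegs) with t₀ , large ← eventually-large nondegs =
    (‖ p ‖ ℕ.+ 2) ℕ.⊔ t₀ ,
    λ t₀≤t → nondegenerate-large p-nondeg (ℕ.≤-trans (ℕ.m≤m⊔n _ t₀) t₀≤t) ∷ large (ℕ.≤-trans (ℕ.m≤n⊔m _ t₀) t₀≤t)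

  nondegenerate-not-λ-quiddity : ∀ {xs} → 1 ≤ length xs → All Nondegenerate xs → ¬ IsLambdaQuiddity xs
  nondegenerate-not-λ-quiddity {xs} 1≤∣xs∣ nondegs q with t , large ← eventually-large nondegs =
    no-large-λ-quiddity (≡.subst (1 ≤_) (≡.sym (List.length-map _ xs)) 1≤∣xs∣) (AllProperties.map⁺ (large ℕ.≤-refl))
      (Eval.λ-quiddity-map (+ t) {xs} q)

  eval-1-cb : ∀ c b t → eval (1# - c * b) t ≡ 1ℤ ℤ.- eval c t ℤ.* eval b t
  eval-1-cb c b t = begin
    eval (1# - c * b) t               ≡⟨ eval-+ 1# (- (c * b)) t ⟩
    eval 1# t ℤ.+ eval (- (c * b)) t  ≡⟨ ≡.cong₂ ℤ._+_ (eval-1 t) (eval-neg (c * b) t) ⟩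
    1ℤ ℤ.- eval (c * b) t             ≡⟨ ≡.cong (λ v → 1ℤ ℤ.- v) (eval-* c b t) ⟩
    1ℤ ℤ.- eval c t ℤ.* eval b t      ∎
    where open ≡.≡-Reasoning

  nondegenerate-1-cb-not-sign : ∀ {b c} → Nondegenerate b → Nondegenerate c → ¬ IsSign (1# - c * b)
  nondegenerate-1-cb-not-sign {b} {c} b-nondeg c-nondeg sign
    with t , large ← eventually-large (b-nondeg ∷ c-nondeg ∷ [])
    with 2≤∣b∣ ∷ 2≤∣c∣ ∷ [] ← large ℕ.≤-refl =
    1-xy-not-sign (eval c (+ t)) (eval b (+ t)) 2≤∣c∣ 2≤∣b∣
      (≡.subst (QuiddityProperties.IsSign ℤ.+-*-commutativeRing) (eval-1-cb c b (+ t)) (Eval.sign-map (+ t) sign))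

  Shape₄ : Poly → List Poly → Set
  Shape₄ P xs = (xs ≋ (0# ∷ P ∷ 0# ∷ (- P) ∷ [])) ⊎ (xs ≋ (P ∷ 0# ∷ (- P) ∷ 0# ∷ []))

  classify₄ : ∀ {a b c d} → IsLambdaQuiddity (a ∷ b ∷ c ∷ d ∷ []) → All (¬_ ∘ IsSign) (a ∷ b ∷ c ∷ d ∷ []) →
              ∃[ P ] (¬ IsSign P × Shape₄ P (a ∷ b ∷ c ∷ d ∷ []))
  classify₄ {a} {b} {c} {d} q (a≉±1 ∷ b≉±1 ∷ c≉±1 ∷ _ ∷ []) = by-cases (c ≟ᵒ 0#) (b ≟ᵒ 0#)
    where
    by-cases : Dec (c ≈ 0#) → Dec (b ≈ 0#) → ∃[ P ] (¬ IsSign P × Shape₄ P (a ∷ b ∷ c ∷ d ∷ []))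
    by-cases (yes c≈0) _         = b , b≉±1 , inj₁ (quiddity₄[c≈0] {a} {b} {c} {d} q c≈0)
    by-cases (no _)    (yes b≈0) = a , a≉±1 , inj₂ (quiddity₄[b≈0] {a} {b} {c} {d} q b≈0)
    by-cases (no c≉0)  (no b≉0)  =
      ⊥-elim (nondegenerate-1-cb-not-sign (b≉0 , b≉±1) (c≉0 , c≉±1) (quiddity₄-sign {a} {b} {c} {d} q))

  IrreducibleForm : List Poly → Set
  IrreducibleForm xs =
    (xs ≋ (1# ∷ 1# ∷ 1# ∷ []))
    ⊎ (xs ≋ ((- 1#) ∷ (- 1#) ∷ (- 1#) ∷ []))
    ⊎ (∃[ P ] ((¬ (P ≈ 1#) × ¬ (P ≈ (- 1#))) × Shape₄ P xs))

  sign-free : ∀ {xs} → Irreducible xs → 4 ≤ length xs → All (¬_ ∘ IsSign) xs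
  sign-free {xs} (_ , _ , irreducible) 4≤∣xs∣ = ¬Any⇒All¬ xs (irreducible ∘ λ any → sign-entry⇒reducible any 4≤∣xs∣)

  zero-free : ∀ {xs} → Irreducible xs → 5 ≤ length xs → All (¬_ ∘ (_≈ 0#)) xs
  zero-free {xs} (_ , _ , irreducible) 5≤∣xs∣ = ¬Any⇒All¬ xs (irreducible ∘ λ any → zero-entry⇒reducible any 5≤∣xs∣)

  shape₄⇒form : ∀ {xs} → ∃[ P ] (¬ IsSign P × Shape₄ P xs) → IrreducibleForm xs
  shape₄⇒form (P , P≉±1 , shape) = inj₂ (inj₂ (P , (P≉±1 ∘ inj₁ , P≉±1 ∘ inj₂) , shape))

  classify : ∀ xs → Irreducible xs → IrreducibleForm xs
  classify (_ ∷ [])                  (s≤s () , _)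
  classify (_ ∷ _ ∷ [])              (s≤s (s≤s ()) , _)
  classify (x ∷ y ∷ z ∷ [])          (_ , q , _) = Sum.map₂ inj₁ (quiddity₃ {x} {y} {z} q)
  classify (a ∷ b ∷ c ∷ d ∷ [])      irr@(_ , q , _) =
    shape₄⇒form (classify₄ {a} {b} {c} {d} q (sign-free {a ∷ b ∷ c ∷ d ∷ []} irr ℕ.≤-refl))
  classify xs@(_ ∷ _ ∷ _ ∷ _ ∷ _ ∷ _) irr@(_ , q , _) =
    ⊥-elim (nondegenerate-not-λ-quiddity {xs} (s≤s z≤n)
      (All.zip (zero-free {xs} irr (s≤s (s≤s (s≤s (s≤s (s≤s z≤n))))) , sign-free {xs} irr (s≤s (s≤s (s≤s (s≤s z≤n)))))) q)

  length≡3⇒irreducible : ∀ {xs} → length xs ≡ 3 → ¬ Reducible xs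
  length≡3⇒irreducible ∣xs∣≡3 r =
    contradiction (≡.subst (4 ≤_) ∣xs∣≡3 (reducible⇒4≤length r)) λ { (s≤s (s≤s (s≤s ()))) }

  sign-free₄⇒irreducible : ∀ {xs} → length xs ≡ 4 → ¬ Any IsSign xs → ¬ Reducible xs
  sign-free₄⇒irreducible ∣xs∣≡4 no-sign r = no-sign (reducible₄⇒sign-entry r ∣xs∣≡4)

  0-not-sign : ¬ IsSign 0#
  0-not-sign = from-no (sign? 0#)

  form⇒irreducible : ∀ xs → IrreducibleForm xs → Irreducible xs
  form⇒irreducible xs (inj₁ xs≋111) =
    ≡.subst (3 ≤_) (≡.sym (Pointwise.Pointwise-length xs≋111)) ℕ.≤-refl ,
    λ-quiddity-resp (≋-sym xs≋111) (sign-triple-quiddity (inj₁ refl)) ,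
    length≡3⇒irreducible (Pointwise.Pointwise-length xs≋111)
  form⇒irreducible xs (inj₂ (inj₁ xs≋-111)) =
    ≡.subst (3 ≤_) (≡.sym (Pointwise.Pointwise-length xs≋-111)) ℕ.≤-refl ,
    λ-quiddity-resp (≋-sym xs≋-111) (sign-triple-quiddity (inj₂ refl)) ,
    length≡3⇒irreducible (Pointwise.Pointwise-length xs≋-111)
  form⇒irreducible xs (inj₂ (inj₂ (P , (P≉1 , P≉-1) , inj₁ xs≋0P0-P))) =
    ≡.subst (3 ≤_) (≡.sym (Pointwise.Pointwise-length xs≋0P0-P)) (s≤s (s≤s (s≤s z≤n))) ,
    λ-quiddity-resp (≋-sym xs≋0P0-P) (0P0-P-quiddity P) ,
    sign-free₄⇒irreducible (Pointwise.Pointwise-length xs≋0P0-P)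
      (All¬⇒¬Any (0-not-sign ∷ P≉±1 ∷ 0-not-sign ∷ P≉±1 ∘ sign⁻ ∷ []) ∘ Pointwise.Any-resp-Pointwise IsSign-resp xs≋0P0-P)
    where
    P≉±1 : ¬ IsSign P
    P≉±1 = Sum.[ P≉1 , P≉-1 ]
  form⇒irreducible xs (inj₂ (inj₂ (P , (P≉1 , P≉-1) , inj₂ xs≋P0-P0))) =
    ≡.subst (3 ≤_) (≡.sym (Pointwise.Pointwise-length xs≋P0-P0)) (s≤s (s≤s (s≤s z≤n))) ,
    λ-quiddity-resp (≋-sym xs≋P0-P0) (P0-P0-quiddity P) ,
    sign-free₄⇒irreducible (Pointwise.Pointwise-length xs≋P0-P0)
      (All¬⇒¬Any (P≉±1 ∷ 0-not-sign ∷ P≉±1 ∘ sign⁻ ∷ 0-not-sign ∷ []) ∘ Pointwise.Any-resp-Pointwise IsSign-resp xs≋P0-P0)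
    where
    P≉±1 : ¬ IsSign P
    P≉±1 = Sum.[ P≉1 , P≉-1 ]

  form⇒length≤4 : ∀ xs → IrreducibleForm xs → length xs ≤ 4
  form⇒length≤4 xs (inj₁ xs≋)                       = ≡.subst (_≤ 4) (≡.sym (Pointwise.Pointwise-length xs≋)) (ℕ.n≤1+n 3)
  form⇒length≤4 xs (inj₂ (inj₁ xs≋))                = ≡.subst (_≤ 4) (≡.sym (Pointwise.Pointwise-length xs≋)) (ℕ.n≤1+n 3)
  form⇒length≤4 xs (inj₂ (inj₂ (_ , _ , inj₁ xs≋))) = ≡.subst (_≤ 4) (≡.sym (Pointwise.Pointwise-length xs≋)) ℕ.≤-refl
  form⇒length≤4 xs (inj₂ (inj₂ (_ , _ , inj₂ xs≋))) = ≡.subst (_≤ 4) (≡.sym (Pointwise.Pointwise-length xs≋)) ℕ.≤-refl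

  irreducible⇔form : ∀ xs → Irreducible xs ⇔ IrreducibleForm xs
  irreducible⇔form xs = mk⇔ (classify xs) (form⇒irreducible xs)

  ℓ[ℤ[X]]≡4 : MaxIrrSize 4
  ℓ[ℤ[X]]≡4 =
    (λ xs irr → form⇒length≤4 xs (classify xs irr)) ,
    (0# ∷ 0# ∷ 0# ∷ 0# ∷ []) ,
    form⇒irreducible _ (inj₂ (inj₂ (0# , (0-not-sign ∘ inj₁ , 0-not-sign ∘ inj₂) , inj₁ ≋-refl))) ,
    ≡.refl

open Quiddity ℤ[X]
open RawRing ℤ[X] using (Carrier; _≈_; -_; 0#; 1#)

opaque
  unfolding _≈ᵒ_

  corollary3p5 : MaxIrrSize 4
      × (∀ (c : List Carrier) → Irreducible c ⇔
          ((c ≋ (1# ∷ 1# ∷ 1# ∷ []))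
           ⊎ (c ≋ ((- 1#) ∷ (- 1#) ∷ (- 1#) ∷ []))
           ⊎ (∃[ P ] ((¬ (P ≈ 1#) × ¬ (P ≈ (- 1#)))
                × ((c ≋ (0# ∷ P ∷ 0# ∷ (- P) ∷ []))
                   ⊎ (c ≋ (P ∷ 0# ∷ (- P) ∷ 0# ∷ [])))))))
  corollary3p5 = ℓ[ℤ[X]]≡4 , irreducible⇔form
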